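{- Let $p$ be an odd prime. Then there exist an IMRS$^*_{(\mathbb{Z}_{2p}\oplus\mathbb{Z}_8)\setminus(\mathbb{Z}_{2p}\oplus\{0,4\})}(p,4;3)$ and an MRS$^*_{\mathbb{Z}_{2p}\oplus\mathbb{Z}_8}(p,4;4)$.
   Context: $\mathbb{Z}_v$ denotes the additive group of integers modulo $v$; $\{0,4\}$ denotes the subgroup of order $2$ of $\mathbb{Z}_8$. For a finite abelian group $(K,+)$ and a subset $T\subseteq K$ with $|T|=xyz$, an IMRS$^*_{T}(x,y;z)$ is a collection of $z$ arrays of size $x\times y$ whose entries are elements of $T$, each element of $T$ appearing exactly once among all the arrays, such that every row sum and every column sum in every array equals $0\in K$. An MRS$^*_K(x,y;z)$ is the same notion with $T=K$. -}

module Defs where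

open import Data.Nat using (ℕ; zero; suc; _+_)
open import Data.Nat.Divisibility using (_∣_)
open import Data.Fin using (Fin; toℕ)
open import Data.Product using (Σ; _×_; _,_; proj₁; proj₂)
open import Relation.Binary.PropositionalEquality using (_≡_)

sumFin : (n : ℕ) → (Fin n → ℕ) → ℕ
sumFin zero    f = 0
sumFin (suc n) f = f Fin.zero + sumFin n (λ i → f (Fin.suc i))

-- the abelian group Z_m ⊕ Z_n, elements represented by canonical residues
Grp : ℕ → ℕ → Set
Grp m n = Fin m × Fin n

SumZero : (m n k : ℕ) → (Fin k → Grp m n) → Set
SumZero m n k f = (m ∣ sumFin k (λ i → toℕ (proj₁ (f i))))
                × (n ∣ sumFin k (λ i → toℕ (proj₂ (f i))))

-- IMRS*_T(x,y;z) in Z_m ⊕ Z_n, T given as a predicate: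
-- z arrays A k of size x×y with entries in T, each element of T used
-- exactly once, all row sums and column sums zero.
IMRS* : (m n : ℕ) → (T : Grp m n → Set) → (x y z : ℕ) → Set
IMRS* m n T x y z =
  Σ (Fin z → Fin x → Fin y → Grp m n) λ A →
      (∀ k i j → T (A k i j))
    × (∀ k i j k' i' j' → A k i j ≡ A k' i' j' → (k ≡ k') × (i ≡ i') × (j ≡ j'))
    × (∀ t → T t → Σ (Fin z) λ k → Σ (Fin x) λ i → Σ (Fin y) λ j → A k i j ≡ t)
    × (∀ k i → SumZero m n y (λ j → A k i j))
    × (∀ k j → SumZero m n x (λ i → A k i j))


MRS* : (m n : ℕ) → (x y z : ℕ) → Set
MRS* m n x y z = IMRS* m n (λ _ → ⊤) x y z
  where open import Data.Unit using (⊤)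

NotIn04 : {m : ℕ} → Grp m 8 → Set
NotIn04 (a , b) = ¬ (toℕ b ≡ 0) × ¬ (toℕ b ≡ 4)
  where open import Relation.Nullary using (¬_)

{-# OPTIONS --safe #-}

-- Write p = 2m + 3. Each array has three special rows, filled with the residues
-- 0, 1, p − 1, p, p + 1, −1 of ℤ/2p, and 2m bulk rows. The other 4m residues form four blocks
-- of m, negation exchanging block q with block 3 − q at the same offset t. Bulk row (t , 0)
-- takes offset t from every block, so its first coordinates form two pairs of opposite
-- residues, and bulk row (t , 1) is its negative, so bulk columns cancel in pairs. A special
-- residue is c p + d with d ∈ {−1, 0, 1}, so a sum of special residues vanishes as soon as
-- Σ c is even and Σ d = 0: whether the special rows and columns sum to zero, and whether every
-- admissible element is used exactly once, no longer depends on p and is decided by evaluation.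

module Submission where

open import Defs
open import Data.Empty using (⊥-elim)
open import Data.Fin using (Fin; toℕ; opposite; splitAt; remQuot; cast)
open import Data.Fin.Patterns using (0F; 1F; 2F; 3F; 4F; 5F; 6F; 7F)
open import Data.Fin.Properties
  using (all?; any?; _≟_; +↔⊎; *↔×; opposite-prop; opposite-involutive; toℕ<n; toℕ-↑ˡ; toℕ-↑ʳ; toℕ-cast; cast-involutive)
open import Data.Nat using (ℕ; zero; suc; _+_; _*_)
open import Data.Nat.Divisibility
  using (_∣_; divides; _∣0; ∣-refl; ∣-reflexive; ∣m∣n⇒∣m+n; ∣m+n∣m⇒∣n; _∣?_)
open import Data.Nat.Primality using (Prime; ¬prime[1])
open import Data.Nat.Properties
  using (+-assoc; +-comm; +-suc; *-identityˡ; *-distribʳ-+; *-assoc; +-cancelʳ-≡; m+[n∸m]≡n)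
import Data.Nat.Properties as ℕ
open import Data.Nat.Tactic.RingSolver using (solve-∀)
open import Data.Product using (Σ; _×_; _,_; proj₁; proj₂; map₁)
open import Data.Product.Properties using (≡-dec; ,-injectiveˡ; ,-injectiveʳ)
open import Data.Product.Function.NonDependent.Propositional using (_×-↔_)
open import Data.Sum using (_⊎_; inj₁; inj₂)
open import Data.Sum.Function.Propositional using (_⊎-↔_)
open import Data.Sum.Properties using (inj₁-injective; inj₂-injective)
open import Data.Unit using (⊤; tt)
open import Data.Vec using (Vec; _∷_; []; lookup)
open import Function using (_∘_; _↔_; Inverse; Injection; mk↔ₛ′)
open import Function.Properties.Inverse using (↔-refl; ↔-sym; ↔-trans; ↔⇒↣)
open import Relation.Binary.Definitions using (DecidableEquality)
open import Relation.Binary.PropositionalEquality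
open import Relation.Nullary using (¬_; Dec; yes)
open import Relation.Nullary.Decidable using (map′; _×-dec_; _→-dec_; ¬?; from-yes)
open import Relation.Unary using (Decidable)

sumFin-cong : ∀ n {f g : Fin n → ℕ} → (∀ i → f i ≡ g i) → sumFin n f ≡ sumFin n g
sumFin-cong zero    f≗g = refl
sumFin-cong (suc n) f≗g = cong₂ _+_ (f≗g Fin.zero) (sumFin-cong n (f≗g ∘ Fin.suc))

sumFin-+ : ∀ n (f g : Fin n → ℕ) → sumFin n (λ i → f i + g i) ≡ sumFin n f + sumFin n g
sumFin-+ zero    f g = refl
sumFin-+ (suc n) f g = begin
  (f₀ + g₀) + sumFin n (λ i → f (Fin.suc i) + g (Fin.suc i))
    ≡⟨ cong ((f₀ + g₀) +_) (sumFin-+ n (f ∘ Fin.suc) (g ∘ Fin.suc)) ⟩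
  (f₀ + g₀) + (sumFin n (f ∘ Fin.suc) + sumFin n (g ∘ Fin.suc))
    ≡⟨ shuffle f₀ g₀ _ _ ⟩
  (f₀ + sumFin n (f ∘ Fin.suc)) + (g₀ + sumFin n (g ∘ Fin.suc)) ∎
  where
  open ≡-Reasoning
  f₀ g₀ : ℕ
  f₀ = f Fin.zero
  g₀ = g Fin.zero
  shuffle : ∀ a b c d → (a + b) + (c + d) ≡ (a + c) + (b + d)
  shuffle = solve-∀

sumFin-*ʳ : ∀ n (f : Fin n → ℕ) c → sumFin n (λ i → f i * c) ≡ sumFin n f * c
sumFin-*ʳ zero    f c = refl
sumFin-*ʳ (suc n) f c =
  trans (cong (f Fin.zero * c +_) (sumFin-*ʳ n (f ∘ Fin.suc) c))
        (sym (*-distribʳ-+ c (f Fin.zero) _))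

sumFin-splitAt : ∀ a b (f : Fin a ⊎ Fin b → ℕ) →
  sumFin (a + b) (f ∘ splitAt a) ≡ sumFin a (f ∘ inj₁) + sumFin b (f ∘ inj₂)
sumFin-splitAt zero    b f = refl
sumFin-splitAt (suc a) b f =
  trans (cong (f (inj₁ Fin.zero) +_) (sumFin-splitAt a b (f ∘ Data.Sum.map₁ Fin.suc)))
        (sym (+-assoc (f (inj₁ Fin.zero)) _ _))

∣-sumFin : ∀ {d} n {f : Fin n → ℕ} → (∀ i → d ∣ f i) → d ∣ sumFin n f
∣-sumFin zero    d∣f = _ ∣0
∣-sumFin (suc n) d∣f = ∣m∣n⇒∣m+n (d∣f Fin.zero) (∣-sumFin n (d∣f ∘ Fin.suc))

∣-sumFin-remQuot : ∀ d m (f : Fin m × Fin 2 → ℕ) →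
  (∀ t → d ∣ f (t , 0F) + f (t , 1F)) → d ∣ sumFin (m * 2) (f ∘ remQuot 2)
∣-sumFin-remQuot d zero    f pairs = d ∣0
∣-sumFin-remQuot d (suc m) f pairs =
  subst (d ∣_) (+-assoc (f (Fin.zero , 0F)) _ _)
    (∣m∣n⇒∣m+n (pairs Fin.zero)
               (∣-sumFin-remQuot d m (λ (t , e) → f (Fin.suc t , e)) (pairs ∘ Fin.suc)))

∣-sumFin-complement : ∀ {d} n (f g : Fin n → ℕ) →
  d ∣ sumFin n f → (∀ i → d ∣ f i + g i) → d ∣ sumFin n g
∣-sumFin-complement n f g d∣Σf d∣f+g =
  ∣m+n∣m⇒∣n (subst (_ ∣_) (sumFin-+ n f g) (∣-sumFin n d∣f+g)) d∣Σf

RowKind : ℕ → Set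
RowKind m = Fin 3 ⊎ (Fin m × Fin 2)

rowKinds : ∀ m → Fin (3 + m * 2) ↔ RowKind m
rowKinds m = ↔-trans +↔⊎ (↔-refl ⊎-↔ *↔×)

∣-sumFin-rowKinds : ∀ d m (f : RowKind m → ℕ) →
  d ∣ sumFin 3 (f ∘ inj₁) → (∀ t → d ∣ f (inj₂ (t , 0F)) + f (inj₂ (t , 1F))) →
  d ∣ sumFin (3 + m * 2) (f ∘ Inverse.to (rowKinds m))
∣-sumFin-rowKinds d m f d∣specials d∣pairs =
  subst (d ∣_) (sym (sumFin-splitAt 3 (m * 2) (f ∘ Inverse.to (↔-refl ⊎-↔ *↔×))))
    (∣m∣n⇒∣m+n d∣specials (∣-sumFin-remQuot d m (f ∘ inj₂) d∣pairs))

-- Writing each term as c i * P + pos i − neg i avoids subtraction.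
2*∣-sumFin-signed : ∀ n P (v c pos neg : Fin n → ℕ) →
  (∀ i → v i + neg i ≡ c i * P + pos i) →
  2 ∣ sumFin n c → sumFin n pos ≡ sumFin n neg → 2 * P ∣ sumFin n v
2*∣-sumFin-signed n P v c pos neg signed (divides K Σc≡K*2) Σpos≡Σneg =
  divides K (+-cancelʳ-≡ (sumFin n neg) _ _ (begin
    sumFin n v + sumFin n neg              ≡⟨ sym (sumFin-+ n v neg) ⟩
    sumFin n (λ i → v i + neg i)           ≡⟨ sumFin-cong n signed ⟩
    sumFin n (λ i → c i * P + pos i)       ≡⟨ sumFin-+ n _ pos ⟩
    sumFin n (λ i → c i * P) + sumFin n pos ≡⟨ cong₂ _+_ (sumFin-*ʳ n c P) Σpos≡Σneg ⟩
    sumFin n c * P + sumFin n neg          ≡⟨ cong (λ x → x * P + sumFin n neg) Σc≡K*2 ⟩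
    K * 2 * P + sumFin n neg               ≡⟨ cong (_+ sumFin n neg) (*-assoc K 2 P) ⟩
    K * (2 * P) + sumFin n neg             ∎))
  where open ≡-Reasoning

suc[toℕ+toℕ-opposite] : ∀ {n} (i : Fin n) → suc (toℕ i + toℕ (opposite i)) ≡ n
suc[toℕ+toℕ-opposite] i rewrite opposite-prop i = m+[n∸m]≡n (toℕ<n i)

negate : ∀ {n} → Fin (suc n) → Fin (suc n)
negate Fin.zero    = Fin.zero
negate (Fin.suc i) = Fin.suc (opposite i)

∣toℕ+toℕ-negate : ∀ {n} (i : Fin (suc n)) → suc n ∣ toℕ i + toℕ (negate i)
∣toℕ+toℕ-negate Fin.zero    = _ ∣0
∣toℕ+toℕ-negate {n} (Fin.suc i) = divides 1 (begin
  suc (toℕ i + suc (toℕ (opposite i))) ≡⟨ cong suc (+-suc (toℕ i) _) ⟩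
  suc (suc (toℕ i + toℕ (opposite i))) ≡⟨ cong suc (suc[toℕ+toℕ-opposite] i) ⟩
  suc n                                ≡⟨ sym (*-identityˡ (suc n)) ⟩
  1 * suc n                            ∎)
  where open ≡-Reasoning

record Enumerates {A B C D : Set} (P : D → Set) (f : A → B → C → D) : Set where
  field
    into      : ∀ a b c → P (f a b c)
    injective : ∀ a b c a′ b′ c′ → f a b c ≡ f a′ b′ c′ → a ≡ a′ × b ≡ b′ × c ≡ c′
    onto      : ∀ d → P d → Σ A λ a → Σ B λ b → Σ C λ c → f a b c ≡ d

enumerates-conj : ∀ {A B B′ C D D′ : Set} {P : D′ → Set} {f : A → B → C → D}
  (g : B′ ↔ B) (h : D ↔ D′) → Enumerates (P ∘ Inverse.to h) f →
  Enumerates P (λ a b c → Inverse.to h (f a (Inverse.to g b) c))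
enumerates-conj {P = P} {f} g h E = record
  { into      = λ a b c → into a (G.to b) c
  ; injective = λ a b c a′ b′ c′ eq →
      let a≡a′ , gb≡gb′ , c≡c′ = injective a (G.to b) c a′ (G.to b′) c′ (Injection.injective (↔⇒↣ h) eq)
      in a≡a′ , Injection.injective (↔⇒↣ g) gb≡gb′ , c≡c′
  ; onto      = λ d Pd →
      let a , b , c , eq = onto (H.from d) (subst P (sym (H.strictlyInverseˡ d)) Pd)
      in a , G.from b , c ,
         trans (cong (λ b′ → H.to (f a b′ c)) (G.strictlyInverseˡ b))
               (trans (cong H.to eq) (H.strictlyInverseˡ d))
  }
  where
  open Enumerates E
  module G = Inverse g
  module H = Inverse h

enumerates? : ∀ {l m n u v} {P : Fin u × Fin v → Set} → Decidable P →
              (f : Fin l → Fin m → Fin n → Fin u × Fin v) → Dec (Enumerates P f)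
enumerates? {l} {m} {n} {u} {v} {P} P? f =
  map′ (λ (i , j , o) → record { into = i ; injective = j ; onto = λ d → o (proj₁ d) (proj₂ d) })
       (λ E → Enumerates.into E , Enumerates.injective E , λ x y → Enumerates.onto E (x , y))
       (into? ×-dec injective? ×-dec onto?)
  where
  _≟²_ : DecidableEquality (Fin u × Fin v)
  _≟²_ = ≡-dec _≟_ _≟_
  into? : Dec (∀ a b c → P (f a b c))
  into? = all? λ a → all? λ b → all? λ c → P? (f a b c)
  injective? : Dec (∀ a b c a′ b′ c′ → f a b c ≡ f a′ b′ c′ → a ≡ a′ × b ≡ b′ × c ≡ c′)
  injective? = all? λ a → all? λ b → all? λ c → all? λ a′ → all? λ b′ → all? λ c′ →
    (f a b c ≟² f a′ b′ c′) →-dec (a ≟ a′ ×-dec b ≟ b′ ×-dec c ≟ c′)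
  onto? : Dec (∀ x y → P (x , y) → Σ (Fin l) λ a → Σ (Fin m) λ b → Σ (Fin n) λ c → f a b c ≡ (x , y))
  onto? = all? λ x → all? λ y → P? (x , y) →-dec
    any? λ a → any? λ b → any? λ c → f a b c ≟² (x , y)

-- value gives toℕ ∘ index in closed form, so that sums of indices can be computed symbolically.
record Indexing (A : Set) (n : ℕ) : Set where
  field
    bijection : A ↔ Fin n
    value     : A → ℕ
    toℕ-value : ∀ a → toℕ (Inverse.to bijection a) ≡ value a

  index : A → Fin n
  index = Inverse.to bijection

finIndexing : ∀ n → Indexing (Fin n) n
finIndexing n = record { bijection = ↔-refl ; value = toℕ ; toℕ-value = λ _ → refl }

infixr 5 _⊕_

_⊕_ : ∀ a {A n} → Indexing A n → Indexing (Fin a ⊎ A) (a + n)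
_⊕_ a {n = n} I = record
  { bijection = ↔-trans (↔-refl ⊎-↔ bijection) (↔-sym +↔⊎)
  ; value     = λ { (inj₁ i) → toℕ i ; (inj₂ x) → a + value x }
  ; toℕ-value = λ { (inj₁ i) → toℕ-↑ˡ i n
                  ; (inj₂ x) → trans (toℕ-↑ʳ a (index x)) (cong (a +_) (toℕ-value x)) }
  }
  where open Indexing I

castIndexing : ∀ {A n n′} → n ≡ n′ → Indexing A n → Indexing A n′
castIndexing eq I = record
  { bijection = ↔-trans bijection
      (mk↔ₛ′ (cast eq) (cast (sym eq)) (cast-involutive eq (sym eq)) (cast-involutive (sym eq) eq))
  ; value     = value
  ; toℕ-value = λ a → trans (toℕ-cast eq (index a)) (toℕ-value a)
  }
  where open Indexing I

reindex : ∀ {A B n} → A ↔ B → Indexing B n → Indexing A n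
reindex g I = record
  { bijection = ↔-trans g bijection
  ; value     = value ∘ Inverse.to g
  ; toℕ-value = toℕ-value ∘ Inverse.to g
  }
  where open Indexing I

-- ℤ/2p in increasing order: 0, 1; two blocks of m; p − 1, p, p + 1; two blocks of m; −1.
Layout : ℕ → Set
Layout m = Fin 2 ⊎ Fin m ⊎ Fin m ⊎ Fin 3 ⊎ Fin m ⊎ Fin m ⊎ Fin 1

-- Six special residues and four blocks of m residues; the two upper blocks are listed
-- downwards, so that negation maps the residue (q , o) to (opposite q , o).
Shape : ℕ → Set
Shape m = Fin 6 ⊎ (Fin 4 × Fin m)

shape↔layout : ∀ m → Shape m ↔ Layout m
shape↔layout m = mk↔ₛ′ place shape place-shape shape-place
  where
  place : Shape m → Layout m
  place (inj₁ 0F)        = inj₁ 0F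
  place (inj₁ 1F)        = inj₁ 1F
  place (inj₁ 2F)        = inj₂ (inj₂ (inj₂ (inj₁ 0F)))
  place (inj₁ 3F)        = inj₂ (inj₂ (inj₂ (inj₁ 1F)))
  place (inj₁ 4F)        = inj₂ (inj₂ (inj₂ (inj₁ 2F)))
  place (inj₁ 5F)        = inj₂ (inj₂ (inj₂ (inj₂ (inj₂ (inj₂ 0F)))))
  place (inj₂ (0F , o)) = inj₂ (inj₁ o)
  place (inj₂ (1F , o)) = inj₂ (inj₂ (inj₁ o))
  place (inj₂ (2F , o)) = inj₂ (inj₂ (inj₂ (inj₂ (inj₁ (opposite o)))))
  place (inj₂ (3F , o)) = inj₂ (inj₂ (inj₂ (inj₂ (inj₂ (inj₁ (opposite o))))))

  shape : Layout m → Shape m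
  shape (inj₁ 0F)                                     = inj₁ 0F
  shape (inj₁ 1F)                                     = inj₁ 1F
  shape (inj₂ (inj₁ o))                               = inj₂ (0F , o)
  shape (inj₂ (inj₂ (inj₁ o)))                        = inj₂ (1F , o)
  shape (inj₂ (inj₂ (inj₂ (inj₁ 0F))))                = inj₁ 2F
  shape (inj₂ (inj₂ (inj₂ (inj₁ 1F))))                = inj₁ 3F
  shape (inj₂ (inj₂ (inj₂ (inj₁ 2F))))                = inj₁ 4F
  shape (inj₂ (inj₂ (inj₂ (inj₂ (inj₁ o)))))          = inj₂ (2F , opposite o)
  shape (inj₂ (inj₂ (inj₂ (inj₂ (inj₂ (inj₁ o))))))   = inj₂ (3F , opposite o)
  shape (inj₂ (inj₂ (inj₂ (inj₂ (inj₂ (inj₂ 0F))))))  = inj₁ 5F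

  place-shape : ∀ ℓ → place (shape ℓ) ≡ ℓ
  place-shape (inj₁ 0F)                                    = refl
  place-shape (inj₁ 1F)                                    = refl
  place-shape (inj₂ (inj₁ o))                              = refl
  place-shape (inj₂ (inj₂ (inj₁ o)))                       = refl
  place-shape (inj₂ (inj₂ (inj₂ (inj₁ 0F))))               = refl
  place-shape (inj₂ (inj₂ (inj₂ (inj₁ 1F))))               = refl
  place-shape (inj₂ (inj₂ (inj₂ (inj₁ 2F))))               = refl
  place-shape (inj₂ (inj₂ (inj₂ (inj₂ (inj₁ o)))))         =
    cong (λ o′ → inj₂ (inj₂ (inj₂ (inj₂ (inj₁ o′))))) (opposite-involutive o)
  place-shape (inj₂ (inj₂ (inj₂ (inj₂ (inj₂ (inj₁ o))))))  =
    cong (λ o′ → inj₂ (inj₂ (inj₂ (inj₂ (inj₂ (inj₁ o′)))))) (opposite-involutive o)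
  place-shape (inj₂ (inj₂ (inj₂ (inj₂ (inj₂ (inj₂ 0F)))))) = refl

  shape-place : ∀ σ → shape (place σ) ≡ σ
  shape-place (inj₁ 0F)        = refl
  shape-place (inj₁ 1F)        = refl
  shape-place (inj₁ 2F)        = refl
  shape-place (inj₁ 3F)        = refl
  shape-place (inj₁ 4F)        = refl
  shape-place (inj₁ 5F)        = refl
  shape-place (inj₂ (0F , o)) = refl
  shape-place (inj₂ (1F , o)) = refl
  shape-place (inj₂ (2F , o)) = cong (λ o′ → inj₂ (2F , o′)) (opposite-involutive o)
  shape-place (inj₂ (3F , o)) = cong (λ o′ → inj₂ (3F , o′)) (opposite-involutive o)

-- The special residue with code s is turns s * p + excess s − deficit s:
-- the codes 0, …, 5 stand for 0, 1, p − 1, p, p + 1 and −1.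
turns excess deficit : Fin 6 → ℕ
turns   = lookup (0 ∷ 0 ∷ 1 ∷ 1 ∷ 1 ∷ 2 ∷ [])
excess  = lookup (0 ∷ 1 ∷ 0 ∷ 0 ∷ 1 ∷ 0 ∷ [])
deficit = lookup (0 ∷ 0 ∷ 1 ∷ 0 ∷ 0 ∷ 1 ∷ [])

module Residues (m : ℕ) where

  p : ℕ
  p = 3 + m * 2

  shapeIndexing : Indexing (Shape m) (2 * p)
  shapeIndexing = reindex (shape↔layout m)
    (castIndexing (size m) (2 ⊕ m ⊕ m ⊕ 3 ⊕ m ⊕ m ⊕ finIndexing 1))
    where
    size : ∀ m → 2 + (m + (m + (3 + (m + (m + 1))))) ≡ 2 * (3 + m * 2)
    size = solve-∀

  open Indexing shapeIndexing public using (bijection; value; toℕ-value)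

  value-special : ∀ s → value (inj₁ s) + deficit s ≡ turns s * p + excess s
  value-special 0F = refl
  value-special 1F = refl
  value-special 2F = identity m
    where identity : ∀ m → 2 + (m + (m + 0)) + 1 ≡ 1 * (3 + m * 2) + 0
          identity = solve-∀
  value-special 3F = identity m
    where identity : ∀ m → 2 + (m + (m + 1)) + 0 ≡ 1 * (3 + m * 2) + 0
          identity = solve-∀
  value-special 4F = identity m
    where identity : ∀ m → 2 + (m + (m + 2)) + 0 ≡ 1 * (3 + m * 2) + 1
          identity = solve-∀
  value-special 5F = identity m
    where identity : ∀ m → 2 + (m + (m + (3 + (m + (m + 0))))) + 1 ≡ 2 * (3 + m * 2) + 0
          identity = solve-∀

  value-block-negation : ∀ q o → value (inj₂ (q , o)) + value (inj₂ (opposite q , o)) ≡ 2 * p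
  value-block-negation 0F o = outer (toℕ o) (toℕ (opposite o)) m (suc[toℕ+toℕ-opposite] o)
    where
    outer : ∀ a r m → suc (a + r) ≡ m → 2 + a + (2 + (m + (m + (3 + (m + r))))) ≡ 2 * (3 + m * 2)
    outer a r .(suc (a + r)) refl = identity a r
      where identity : ∀ a r → 2 + a + (2 + (suc (a + r) + (suc (a + r) + (3 + (suc (a + r) + r)))))
                                 ≡ 2 * (3 + suc (a + r) * 2)
            identity = solve-∀
  value-block-negation 1F o = inner (toℕ o) (toℕ (opposite o)) m (suc[toℕ+toℕ-opposite] o)
    where
    inner : ∀ a r m → suc (a + r) ≡ m → 2 + (m + a) + (2 + (m + (m + (3 + r)))) ≡ 2 * (3 + m * 2)
    inner a r .(suc (a + r)) refl = identity a r
      where identity : ∀ a r → 2 + (suc (a + r) + a) + (2 + (suc (a + r) + (suc (a + r) + (3 + r))))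
                                 ≡ 2 * (3 + suc (a + r) * 2)
            identity = solve-∀
  value-block-negation 2F o = trans (+-comm (value (inj₂ (2F , o))) _) (value-block-negation 1F o)
  value-block-negation 3F o = trans (+-comm (value (inj₂ (3F , o))) _) (value-block-negation 0F o)

  2p∣value-block-negation : ∀ q o → 2 * p ∣ value (inj₂ (q , o)) + value (inj₂ (opposite q , o))
  2p∣value-block-negation q o = ∣-reflexive (sym (value-block-negation q o))

  2p∣value-blocks : ∀ o → 2 * p ∣ sumFin 4 (λ q → value (inj₂ (q , o)))
  2p∣value-blocks o = subst (2 * p ∣_) (sym (pair-up (v 0F) (v 1F) (v 2F) (v 3F)))
    (∣m∣n⇒∣m+n (2p∣value-block-negation 0F o) (2p∣value-block-negation 1F o))
    where
    v : Fin 4 → ℕ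
    v q = value (inj₂ (q , o))
    pair-up : ∀ a b c d → a + (b + (c + (d + 0))) ≡ (a + d) + (b + c)
    pair-up = solve-∀

-- The three special rows of each array, and the second coordinates of bulk row (t , 0), whose
-- entry in column q has first coordinate (q , t); bulk row (t , 1) is the negative of (t , 0).
record Pattern (z : ℕ) : Set where
  field
    special : Fin z → Fin 3 → Fin 4 → Fin 6 × Fin 8
    bulk    : Fin z → Fin 4 → Fin 8

  bulkEntry : Fin z → Fin 2 → Fin 4 → Fin 4 × Fin 8
  bulkEntry k 0F j = j , bulk k j
  bulkEntry k 1F j = opposite j , negate (bulk k j)

Balanced : ∀ n → (Fin n → Fin 6 × Fin 8) → Set
Balanced n f = 2 ∣ sumFin n (turns ∘ proj₁ ∘ f)
             × sumFin n (excess ∘ proj₁ ∘ f) ≡ sumFin n (deficit ∘ proj₁ ∘ f)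
             × 8 ∣ sumFin n (toℕ ∘ proj₂ ∘ f)

record Valid {z} (T : Fin 8 → Set) (P : Pattern z) : Set where
  open Pattern P
  field
    special-enumerates : Enumerates (T ∘ proj₂) special
    bulk-enumerates    : Enumerates (T ∘ proj₂) bulkEntry
    special-rows       : ∀ k s → Balanced 4 (special k s)
    special-columns    : ∀ k j → Balanced 3 (λ s → special k s j)
    bulk-rows          : ∀ k → 8 ∣ sumFin 4 (toℕ ∘ bulk k)

valid? : ∀ {z T} → Decidable T → (P : Pattern z) → Dec (Valid T P)
valid? T? P = map′
  (λ (se , be , sr , sc , br) → record
     { special-enumerates = se ; bulk-enumerates = be
     ; special-rows = sr ; special-columns = sc ; bulk-rows = br })
  (λ V → let open Valid V in
     special-enumerates , bulk-enumerates , special-rows , special-columns , bulk-rows)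
  (enumerates? (T? ∘ proj₂) special ×-dec enumerates? (T? ∘ proj₂) bulkEntry
   ×-dec (all? λ k → all? λ s → balanced? 4 (special k s))
   ×-dec (all? λ k → all? λ j → balanced? 3 (λ s → special k s j))
   ×-dec (all? λ k → 8 ∣? sumFin 4 (toℕ ∘ bulk k)))
  where
  open Pattern P
  balanced? : ∀ n f → Dec (Balanced n f)
  balanced? n f = 2 ∣? _ ×-dec ℕ._≟_ _ _ ×-dec 8 ∣? _

module Construction {z} {T : Fin 8 → Set} {P : Pattern z} (V : Valid T P) (m : ℕ) where
  open Pattern P
  open Valid V
  open Residues m

  entry : Fin z → RowKind m → Fin 4 → Shape m × Fin 8
  entry k (inj₁ s)       j = map₁ inj₁ (special k s j)
  entry k (inj₂ (t , e)) j = map₁ (λ q → inj₂ (q , t)) (bulkEntry k e j)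

  entry-enumerates : Enumerates (T ∘ proj₂) entry
  entry-enumerates = record { into = into ; injective = injective ; onto = onto }
    where
    module S = Enumerates special-enumerates
    module B = Enumerates bulk-enumerates

    into : ∀ k κ j → T (proj₂ (entry k κ j))
    into k (inj₁ s)       j = S.into k s j
    into k (inj₂ (t , e)) j = B.into k e j

    injective : ∀ k κ j k′ κ′ j′ → entry k κ j ≡ entry k′ κ′ j′ → k ≡ k′ × κ ≡ κ′ × j ≡ j′
    injective k (inj₁ s) j k′ (inj₁ s′) j′ eq =
      let k≡k′ , s≡s′ , j≡j′ = S.injective k s j k′ s′ j′
                                 (cong₂ _,_ (inj₁-injective (cong proj₁ eq)) (cong proj₂ eq))
      in k≡k′ , cong inj₁ s≡s′ , j≡j′
    injective k (inj₂ (t , e)) j k′ (inj₂ (t′ , e′)) j′ eq =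
      let qt≡qt′ = inj₂-injective (cong proj₁ eq)
          k≡k′ , e≡e′ , j≡j′ = B.injective k e j k′ e′ j′
                                 (cong₂ _,_ (,-injectiveˡ qt≡qt′) (cong proj₂ eq))
      in k≡k′ , cong₂ (λ t e → inj₂ (t , e)) (,-injectiveʳ qt≡qt′) e≡e′ , j≡j′
    injective k (inj₁ _) j k′ (inj₂ _) j′ eq with () ← cong proj₁ eq
    injective k (inj₂ _) j k′ (inj₁ _) j′ eq with () ← cong proj₁ eq

    onto : ∀ d → T (proj₂ d) → Σ (Fin z) λ k → Σ (RowKind m) λ κ → Σ (Fin 4) λ j → entry k κ j ≡ d
    onto (inj₁ c , y) Ty =
      let k , s , j , eq = S.onto (c , y) Ty in k , inj₁ s , j , cong (map₁ inj₁) eq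
    onto (inj₂ (q , t) , y) Ty =
      let k , e , j , eq = B.onto (q , y) Ty in k , inj₂ (t , e) , j , cong (map₁ (λ q → inj₂ (q , t))) eq

  cell↔ : (Shape m × Fin 8) ↔ Grp (2 * p) 8
  cell↔ = bijection ×-↔ ↔-refl

  kind : Fin p → RowKind m
  kind = Inverse.to (rowKinds m)

  array : Fin z → Fin p → Fin 4 → Grp (2 * p) 8
  array k i j = Inverse.to cell↔ (entry k (kind i) j)

  SumsVanish : ∀ n → (Fin n → Shape m × Fin 8) → Set
  SumsVanish n f = 2 * p ∣ sumFin n (value ∘ proj₁ ∘ f) × 8 ∣ sumFin n (toℕ ∘ proj₂ ∘ f)

  sumsVanish⇒SumZero : ∀ {n} (f : Fin n → Shape m × Fin 8) → SumsVanish n f → SumZero (2 * p) 8 n (Inverse.to cell↔ ∘ f)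
  sumsVanish⇒SumZero {n} f (2p∣Σx , 8∣Σy) =
    subst (2 * p ∣_) (sym (sumFin-cong n (toℕ-value ∘ proj₁ ∘ f))) 2p∣Σx , 8∣Σy

  balanced⇒sumsVanish : ∀ {n} (f : Fin n → Fin 6 × Fin 8) → Balanced n f → SumsVanish n (map₁ inj₁ ∘ f)
  balanced⇒sumsVanish {n} f (2∣Σturns , Σexcess≡Σdeficit , 8∣Σy) =
    2*∣-sumFin-signed n p (value ∘ inj₁ ∘ c) (turns ∘ c) (excess ∘ c) (deficit ∘ c)
      (value-special ∘ c) 2∣Σturns Σexcess≡Σdeficit , 8∣Σy
    where
    c : Fin n → Fin 6
    c = proj₁ ∘ f

  bulk-negation : ∀ k t j →
    2 * p ∣ value (proj₁ (entry k (inj₂ (t , 0F)) j)) + value (proj₁ (entry k (inj₂ (t , 1F)) j))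
    × 8 ∣ toℕ (bulk k j) + toℕ (negate (bulk k j))
  bulk-negation k t j =
    2p∣value-block-negation j t , ∣toℕ+toℕ-negate (bulk k j)

  sumsVanish-row : ∀ k κ → SumsVanish 4 (entry k κ)
  sumsVanish-row k (inj₁ s)        = balanced⇒sumsVanish (special k s) (special-rows k s)
  sumsVanish-row k (inj₂ (t , 0F)) = 2p∣value-blocks t , bulk-rows k
  sumsVanish-row k (inj₂ (t , 1F)) =
    ∣-sumFin-complement 4 (x 0F) (x 1F) (2p∣value-blocks t) (proj₁ ∘ bulk-negation k t) ,
    ∣-sumFin-complement 4 (y 0F) (y 1F) (bulk-rows k) (proj₂ ∘ bulk-negation k t)
    where x y : Fin 2 → Fin 4 → ℕ
          x e = value ∘ proj₁ ∘ entry k (inj₂ (t , e))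
          y e = toℕ ∘ proj₂ ∘ entry k (inj₂ (t , e))

  sumsVanish-column : ∀ k j → SumsVanish p (λ i → entry k (kind i) j)
  sumsVanish-column k j =
    ∣-sumFin-rowKinds (2 * p) m (value ∘ proj₁ ∘ column) (proj₁ specials) (λ t → proj₁ (bulk-negation k t j)) ,
    ∣-sumFin-rowKinds 8 m (toℕ ∘ proj₂ ∘ column) (proj₂ specials) (λ t → proj₂ (bulk-negation k t j))
    where
    column : RowKind m → Shape m × Fin 8
    column κ = entry k κ j
    specials : SumsVanish 3 (λ s → entry k (inj₁ s) j)
    specials = balanced⇒sumsVanish (λ s → special k s j) (special-columns k j)

  imrs : IMRS* (2 * p) 8 (T ∘ proj₂) p 4 z
  imrs = array , into , injective , onto
       , (λ k i → sumsVanish⇒SumZero (entry k (kind i)) (sumsVanish-row k (kind i)))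
       , (λ k j → sumsVanish⇒SumZero (λ i → entry k (kind i) j) (sumsVanish-column k j))
    where open Enumerates (enumerates-conj {P = T ∘ proj₂} (rowKinds m) cell↔ entry-enumerates)

table₂ : ∀ {A : Set} {a b} → Vec (Vec A b) a → Fin a → Fin b → A
table₂ v k = lookup (lookup v k)

table₃ : ∀ {A : Set} {a b c} → Vec (Vec (Vec A c) b) a → Fin a → Fin b → Fin c → A
table₃ v k = table₂ (lookup v k)

pattern₃ : Pattern 3
pattern₃ = record
  { special = table₃
      ((((0F , 1F) ∷ (0F , 2F) ∷ (0F , 6F) ∷ (0F , 7F) ∷ []) ∷
        ((1F , 5F) ∷ (2F , 3F) ∷ (5F , 1F) ∷ (4F , 7F) ∷ []) ∷
        ((5F , 2F) ∷ (4F , 3F) ∷ (1F , 1F) ∷ (2F , 2F) ∷ []) ∷ []) ∷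
       (((0F , 3F) ∷ (0F , 5F) ∷ (3F , 5F) ∷ (3F , 3F) ∷ []) ∷
        ((1F , 6F) ∷ (4F , 6F) ∷ (2F , 1F) ∷ (5F , 3F) ∷ []) ∷
        ((5F , 7F) ∷ (2F , 5F) ∷ (1F , 2F) ∷ (4F , 2F) ∷ []) ∷ []) ∷
       (((1F , 3F) ∷ (2F , 7F) ∷ (4F , 1F) ∷ (5F , 5F) ∷ []) ∷
        ((2F , 6F) ∷ (1F , 7F) ∷ (5F , 6F) ∷ (4F , 5F) ∷ []) ∷
        ((3F , 7F) ∷ (3F , 2F) ∷ (3F , 1F) ∷ (3F , 6F) ∷ []) ∷ []) ∷ [])
  ; bulk = table₂
      ((1F ∷ 7F ∷ 7F ∷ 1F ∷ []) ∷
       (2F ∷ 6F ∷ 6F ∷ 2F ∷ []) ∷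
       (3F ∷ 5F ∷ 5F ∷ 3F ∷ []) ∷ [])
  }

pattern₄ : Pattern 4
pattern₄ = record
  { special = table₃
      ((((0F , 0F) ∷ (0F , 1F) ∷ (5F , 4F) ∷ (1F , 3F) ∷ []) ∷
        ((1F , 0F) ∷ (2F , 3F) ∷ (0F , 2F) ∷ (3F , 3F) ∷ []) ∷
        ((5F , 0F) ∷ (4F , 4F) ∷ (1F , 2F) ∷ (2F , 2F) ∷ []) ∷ []) ∷
       (((0F , 3F) ∷ (4F , 0F) ∷ (3F , 0F) ∷ (5F , 5F) ∷ []) ∷
        ((2F , 6F) ∷ (0F , 4F) ∷ (1F , 1F) ∷ (3F , 5F) ∷ []) ∷
        ((4F , 7F) ∷ (2F , 4F) ∷ (2F , 7F) ∷ (4F , 6F) ∷ []) ∷ []) ∷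
       (((0F , 5F) ∷ (1F , 5F) ∷ (2F , 0F) ∷ (3F , 6F) ∷ []) ∷
        ((1F , 4F) ∷ (3F , 2F) ∷ (3F , 1F) ∷ (5F , 1F) ∷ []) ∷
        ((5F , 7F) ∷ (2F , 1F) ∷ (1F , 7F) ∷ (4F , 1F) ∷ []) ∷ []) ∷
       (((0F , 6F) ∷ (0F , 7F) ∷ (3F , 4F) ∷ (3F , 7F) ∷ []) ∷
        ((2F , 5F) ∷ (1F , 6F) ∷ (5F , 2F) ∷ (4F , 3F) ∷ []) ∷
        ((4F , 5F) ∷ (5F , 3F) ∷ (4F , 2F) ∷ (5F , 6F) ∷ []) ∷ []) ∷ [])
  ; bulk = table₂
      ((1F ∷ 7F ∷ 7F ∷ 1F ∷ []) ∷
       (2F ∷ 6F ∷ 6F ∷ 2F ∷ []) ∷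
       (3F ∷ 5F ∷ 5F ∷ 3F ∷ []) ∷
       (0F ∷ 4F ∷ 0F ∷ 4F ∷ []) ∷ [])
  }

-- NotIn04 unfolds to Not04 ∘ proj₂.
Not04 : Fin 8 → Set
Not04 y = ¬ toℕ y ≡ 0 × ¬ toℕ y ≡ 4

valid₃ : Valid Not04 pattern₃
valid₃ = from-yes (valid? (λ y → ¬? (toℕ y ℕ.≟ 0) ×-dec ¬? (toℕ y ℕ.≟ 4)) pattern₃)

valid₄ : Valid (λ _ → ⊤) pattern₄
valid₄ = from-yes (valid? (λ _ → yes tt) pattern₄)

¬2∣⇒1+k*2 : ∀ n → ¬ 2 ∣ n → Σ ℕ λ k → n ≡ 1 + k * 2
¬2∣⇒1+k*2 zero          2∤n = ⊥-elim (2∤n (2 ∣0))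
¬2∣⇒1+k*2 (suc zero)    2∤n = 0 , refl
¬2∣⇒1+k*2 (suc (suc n)) 2∤n =
  let k , n≡1+2k = ¬2∣⇒1+k*2 n (2∤n ∘ ∣m∣n⇒∣m+n ∣-refl) in suc k , cong (2 +_) n≡1+2k

lemma4p3 : (p : ℕ) → Prime p → ¬ (2 ∣ p) →
    IMRS* (2 * p) 8 NotIn04 p 4 3 × MRS* (2 * p) 8 p 4 4
lemma4p3 p p-prime 2∤p with ¬2∣⇒1+k*2 p 2∤p
... | zero  , refl = ⊥-elim (¬prime[1] p-prime)
... | suc m , refl = Construction.imrs valid₃ m , Construction.imrs valid₄ m
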